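{- Let $n\ge2$ be an integer. If there is no sharply transitive subset of $C_{n-1}\wr S_n$ on the set of pairs $((c_1,i_1),(c_2,i_2))\in(C_{n-1}\times[n])^2$ with $i_1\neq i_2$ (i.e. no $2$-design of index $1$ in $C_{n-1}\wr S_n$), then there is no projective plane of order $n-1$ or there is no projective plane of order $n$.
   Context: $C_m=\mathbb{Z}/m\mathbb{Z}$, $[n]=\{1,\dots,n\}$. $C_m\wr S_n$ consists of pairs $(g,\pi)$, $g\in C_m^n$, $\pi\in S_n$, with $(f,\pi)(g,\sigma)=(f+g^\pi,\pi\sigma)$, $g^\pi=(g_{\pi^{ -1}(1)},\dots,g_{\pi^{ -1}(n)})$, acting on $C_m\times[n]$ by $(g,\pi)\cdot(c,i)=(c+g_{\pi(i)},\pi(i))$ and componentwise on pairs. A subset $Y$ is sharply transitive on a set $\Omega$ if for all $a,b\in\Omega$ exactly one $y\in Y$ satisfies $ya=b$. A projective plane of order $m$ is a finite projective plane with $m+1$ points on each line. -}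

module Defs where

open import Data.Nat using (ℕ; zero; suc; _+_; _*_)
open import Data.Nat.DivMod using (_mod_)
open import Data.Fin using (Fin; toℕ)
open import Data.Fin.Permutation using (Permutation′; _⟨$⟩ʳ_)
open import Data.Product using (Σ; ∃; _×_; _,_)
open import Data.Bool using (Bool; true; false; T)
open import Data.List using (List; length; filter; allFin)
open import Relation.Binary.PropositionalEquality using (_≡_)
open import Relation.Nullary using (¬_)
open import Data.Bool.Properties using (T?)

_⊕_ : {m : ℕ} → Fin m → Fin m → Fin m
_⊕_ {suc k} a b = (toℕ a + toℕ b) mod suc k

record Wr (m n : ℕ) : Set where
  constructor ⟨_,_⟩
  field
    g : Fin n → Fin m
    π : Permutation′ n
open Wr public

_≈W_ : {m n : ℕ} → Wr m n → Wr m n → Set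
x ≈W y = (∀ i → g x i ≡ g y i) × (∀ i → π x ⟨$⟩ʳ i ≡ π y ⟨$⟩ʳ i)

act : {m n : ℕ} → Wr m n → Fin m × Fin n → Fin m × Fin n
act x (c , i) = (c ⊕ g x (π x ⟨$⟩ʳ i)) , (π x ⟨$⟩ʳ i)

act₂ : {m n : ℕ} → Wr m n → (Fin m × Fin n) × (Fin m × Fin n)
     → (Fin m × Fin n) × (Fin m × Fin n)
act₂ x (a , b) = act x a , act x b

Ω : {m n : ℕ} → (Fin m × Fin n) × (Fin m × Fin n) → Set
Ω ((c₁ , i₁) , (c₂ , i₂)) = ¬ (i₁ ≡ i₂)

SharplyTransitive : {m n : ℕ} → (Wr m n → Set) → Set
SharplyTransitive {m} {n} Y =
  ∀ a b → Ω {m} {n} a → Ω {m} {n} b →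
    (Σ (Wr m n) λ y → Y y × act₂ y a ≡ b) ×
    (∀ y y' → Y y → Y y' → act₂ y a ≡ b → act₂ y' a ≡ b → y ≈W y')

record ProjectivePlane : Set₁ where
  field
    nPoints nLines : ℕ
    I : Fin nPoints → Fin nLines → Bool
    line-unique : ∀ x y → ¬ (x ≡ y) →
      Σ (Fin nLines) λ L → (T (I x L) × T (I y L)) ×
        (∀ L' → T (I x L') → T (I y L') → L' ≡ L)
    point-unique : ∀ L M → ¬ (L ≡ M) →
      Σ (Fin nPoints) λ x → (T (I x L) × T (I x M)) ×
        (∀ x' → T (I x' L) → T (I x' M) → x' ≡ x)
    nondeg : Σ (Fin nPoints) λ a → Σ (Fin nPoints) λ b →
             Σ (Fin nPoints) λ c → Σ (Fin nPoints) λ d →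
      (¬ a ≡ b × ¬ a ≡ c × ¬ a ≡ d × ¬ b ≡ c × ¬ b ≡ d × ¬ c ≡ d) ×
      (∀ L → ¬ (T (I a L) × T (I b L) × T (I c L))) ×
      (∀ L → ¬ (T (I a L) × T (I b L) × T (I d L))) ×
      (∀ L → ¬ (T (I a L) × T (I c L) × T (I d L))) ×
      (∀ L → ¬ (T (I b L) × T (I c L) × T (I d L)))

  pointsOn : Fin nLines → List (Fin nPoints)
  pointsOn L = filter (λ x → T? (I x L)) (allFin nPoints)

HasOrder : ProjectivePlane → ℕ → Set
HasOrder P m = ∀ L → length (ProjectivePlane.pointsOn P L) ≡ suc m

ExistsProjectivePlane : ℕ → Set₁
ExistsProjectivePlane m = Σ ProjectivePlane λ P → HasOrder P m

-- A plane of order n − 1 yields an orthogonal array with n columns over C_{n-1}: fix a line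
-- L∞, let the columns be its n points p and the rows the points x off L∞, and record in column p
-- which of the n − 1 lines through p other than L∞ contains x. Two columns p₁ ≠ p₂ and two such
-- lines through them meet in exactly one point, so any two entries determine the row.
-- A plane of order n yields a sharply 2-transitive set of permutations of an n-set: for two
-- lines ℓ ≠ ℓ′ and each centre D off both, project the n points of ℓ′ ∖ ℓ from D onto ℓ ∖ ℓ′.
-- Prescribing the images of two points forces D onto two distinct lines, hence determines it.
-- In C_{n-1} ≀ S_n, the pairs (row, permutation) then act sharply transitively on Ω: the
-- permutation is fixed by i₁ ↦ j₁, i₂ ↦ j₂, and the row by its entries d₁ − c₁, d₂ − c₂ there.
module Submission where

open import Defs
open import Data.Nat using (ℕ; suc; _+_; _∸_; _%_; _≤_; s≤s; z≤n)
open import Data.Nat.Properties using (+-comm; +-assoc; m+[n∸m]≡n; <⇒≤)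
open import Data.Nat.DivMod using (_mod_; %-distribˡ-+; m%n%n≡m%n; [m+n]%n≡m%n; m<n⇒m%n≡m)
open import Data.Fin using (Fin; zero; suc; toℕ; punchIn; punchOut; cast)
open import Data.Fin.Properties
  using (toℕ-injective; toℕ-fromℕ<; toℕ<n; cast-involutive;
         punchIn-injective; punchInᵢ≢i; punchIn-punchOut)
open import Data.Fin.Permutation using (Permutation′; _⟨$⟩ʳ_; permutation)
open import Data.Product using (Σ; _×_; _,_; proj₁; proj₂)
open import Data.Bool using (T)
open import Data.Bool.Properties using (T?)
open import Data.List using (List; lookup; allFin)
open import Data.List.Relation.Unary.Any as Any using ()
open import Data.List.Relation.Unary.Any.Properties using (lookup-index)
open import Data.List.Relation.Unary.All as All using ()
open import Data.List.Relation.Unary.Unique.Propositional using (Unique; _∷_)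
import Data.List.Relation.Unary.Unique.Propositional.Properties as Unique
open import Data.List.Membership.Propositional.Properties using (∈-filter⁺; ∈-filter⁻; ∈-lookup; ∈-allFin)
open import Relation.Binary.PropositionalEquality
  using (_≡_; _≢_; _≗_; refl; sym; trans; cong; cong₂; subst; ≢-sym; module ≡-Reasoning)
open import Relation.Nullary using (¬_; Dec; yes; no; contradiction)
open import Function using (_∘_)

lookup-injective : ∀ {A : Set} {xs : List A} → Unique xs →
  ∀ {i j} → lookup xs i ≡ lookup xs j → i ≡ j
lookup-injective (_ ∷ _)      {zero}  {zero}  _  = refl
lookup-injective (x∉xs ∷ _)   {zero}  {suc j} eq = contradiction eq (All.lookup x∉xs (∈-lookup j))
lookup-injective (x∉xs ∷ _)   {suc i} {zero}  eq = contradiction (sym eq) (All.lookup x∉xs (∈-lookup i))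
lookup-injective (_ ∷ unique) {suc i} {suc j} eq = cong suc (lookup-injective unique eq)

_⊖_ : ∀ {m} → Fin m → Fin m → Fin m
_⊖_ {suc k} d c = (toℕ d + (suc k ∸ toℕ c)) mod suc k

module _ {k : ℕ} where
  open ≡-Reasoning

  private
    s : ℕ
    s = suc k

    [a%s+b]%s : ∀ a b → (a % s + b) % s ≡ (a + b) % s
    [a%s+b]%s a b = begin
      (a % s + b) % s           ≡⟨ %-distribˡ-+ (a % s) b s ⟩
      (a % s % s + b % s) % s   ≡⟨ cong (λ t → (t + b % s) % s) (m%n%n≡m%n a s) ⟩
      (a % s + b % s) % s       ≡⟨ %-distribˡ-+ a b s ⟨
      (a + b) % s               ∎

    [a+b%s]%s : ∀ a b → (a + b % s) % s ≡ (a + b) % s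
    [a+b%s]%s a b = begin
      (a + b % s) % s   ≡⟨ cong (_% s) (+-comm a (b % s)) ⟩
      (b % s + a) % s   ≡⟨ [a%s+b]%s b a ⟩
      (b + a) % s       ≡⟨ cong (_% s) (+-comm b a) ⟩
      (a + b) % s       ∎

    toℕ-⊕ : (a b : Fin s) → toℕ (a ⊕ b) ≡ (toℕ a + toℕ b) % s
    toℕ-⊕ a b = toℕ-fromℕ< _

    toℕ-⊖ : (a b : Fin s) → toℕ (a ⊖ b) ≡ (toℕ a + (s ∸ toℕ b)) % s
    toℕ-⊖ a b = toℕ-fromℕ< _

    [c+a+[s∸c]]%s : (c : Fin s) (a : Fin s) → (toℕ c + toℕ a + (s ∸ toℕ c)) % s ≡ toℕ a
    [c+a+[s∸c]]%s c a = begin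
      (toℕ c + toℕ a + (s ∸ toℕ c)) % s   ≡⟨ cong (λ t → (t + (s ∸ toℕ c)) % s) (+-comm (toℕ c) (toℕ a)) ⟩
      (toℕ a + toℕ c + (s ∸ toℕ c)) % s   ≡⟨ cong (_% s) (+-assoc (toℕ a) (toℕ c) _) ⟩
      (toℕ a + (toℕ c + (s ∸ toℕ c))) % s ≡⟨ cong (λ t → (toℕ a + t) % s) (m+[n∸m]≡n (<⇒≤ (toℕ<n c))) ⟩
      (toℕ a + s) % s                     ≡⟨ [m+n]%n≡m%n (toℕ a) s ⟩
      toℕ a % s                           ≡⟨ m<n⇒m%n≡m (toℕ<n a) ⟩
      toℕ a                               ∎

  c⊕[d⊖c]≡d : (c d : Fin s) → c ⊕ (d ⊖ c) ≡ d
  c⊕[d⊖c]≡d c d = toℕ-injective (begin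
    toℕ (c ⊕ (d ⊖ c))                        ≡⟨ toℕ-⊕ c (d ⊖ c) ⟩
    (toℕ c + toℕ (d ⊖ c)) % s                ≡⟨ cong (λ t → (toℕ c + t) % s) (toℕ-⊖ d c) ⟩
    (toℕ c + (toℕ d + (s ∸ toℕ c)) % s) % s  ≡⟨ [a+b%s]%s (toℕ c) _ ⟩
    (toℕ c + (toℕ d + (s ∸ toℕ c))) % s      ≡⟨ cong (_% s) (+-assoc (toℕ c) (toℕ d) _) ⟨
    (toℕ c + toℕ d + (s ∸ toℕ c)) % s        ≡⟨ [c+a+[s∸c]]%s c d ⟩
    toℕ d                                    ∎)

  [c⊕x]⊖c≡x : (c x : Fin s) → (c ⊕ x) ⊖ c ≡ x
  [c⊕x]⊖c≡x c x = toℕ-injective (begin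
    toℕ ((c ⊕ x) ⊖ c)                        ≡⟨ toℕ-⊖ (c ⊕ x) c ⟩
    (toℕ (c ⊕ x) + (s ∸ toℕ c)) % s          ≡⟨ cong (λ t → (t + (s ∸ toℕ c)) % s) (toℕ-⊕ c x) ⟩
    ((toℕ c + toℕ x) % s + (s ∸ toℕ c)) % s  ≡⟨ [a%s+b]%s (toℕ c + toℕ x) _ ⟩
    (toℕ c + toℕ x + (s ∸ toℕ c)) % s        ≡⟨ [c+a+[s∸c]]%s c x ⟩
    toℕ x                                    ∎)

module _ {q n : ℕ} (y : Wr (suc q) n) (c : Fin (suc q)) (i : Fin n) (d : Fin (suc q)) (j : Fin n) where

  act-≡⁺ : π y ⟨$⟩ʳ i ≡ j → g y j ≡ d ⊖ c → act y (c , i) ≡ (d , j)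
  act-≡⁺ refl gj≡d⊖c = cong (_, _) (trans (cong (c ⊕_) gj≡d⊖c) (c⊕[d⊖c]≡d c d))

  act-≡⁻ : act y (c , i) ≡ (d , j) → π y ⟨$⟩ʳ i ≡ j × g y j ≡ d ⊖ c
  act-≡⁻ refl = refl , sym ([c⊕x]⊖c≡x c _)

OrthogonalArray : ∀ {n} {A : Set} → ((Fin n → A) → Set) → Set
OrthogonalArray {n} {A} G = ∀ {j₁ j₂} → j₁ ≢ j₂ → ∀ v₁ v₂ →
  let Matches f = G f × f j₁ ≡ v₁ × f j₂ ≡ v₂ in
  Σ (Fin n → A) Matches × (∀ {f f′} → Matches f → Matches f′ → f ≗ f′)

SharplyTwoTransitive : ∀ {n} → (Permutation′ n → Set) → Set
SharplyTwoTransitive {n} T = ∀ {i₁ i₂ j₁ j₂ : Fin n} → i₁ ≢ i₂ → j₁ ≢ j₂ →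
  let Matches σ = T σ × σ ⟨$⟩ʳ i₁ ≡ j₁ × σ ⟨$⟩ʳ i₂ ≡ j₂ in
  Σ (Permutation′ n) Matches × (∀ {σ τ} → Matches σ → Matches τ → (σ ⟨$⟩ʳ_) ≗ (τ ⟨$⟩ʳ_))

_⋊_ : ∀ {m n} → ((Fin n → Fin m) → Set) → (Permutation′ n → Set) → Wr m n → Set
(G ⋊ T) y = G (g y) × T (π y)

⋊-sharplyTransitive : ∀ {q n} {G : (Fin n → Fin (suc q)) → Set} {T : Permutation′ n → Set} →
  OrthogonalArray G → SharplyTwoTransitive T → SharplyTransitive (G ⋊ T)
⋊-sharplyTransitive orthogonal transitive ((c₁ , i₁) , (c₂ , i₂)) ((d₁ , j₁) , (d₂ , j₂)) i₁≢i₂ j₁≢j₂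
  with transitive i₁≢i₂ j₁≢j₂ | orthogonal j₁≢j₂ (d₁ ⊖ c₁) (d₂ ⊖ c₂)
... | (σ , σ∈T , σi₁ , σi₂) , same-permutation | (f , f∈G , fj₁ , fj₂) , same-row =
  (⟨ f , σ ⟩ , (f∈G , σ∈T) ,
     cong₂ _,_ (act-≡⁺ ⟨ f , σ ⟩ c₁ i₁ d₁ j₁ σi₁ fj₁) (act-≡⁺ ⟨ f , σ ⟩ c₂ i₂ d₂ j₂ σi₂ fj₂)) ,
  λ y y′ (gy∈G , πy∈T) (gy′∈G , πy′∈T) ya≡b y′a≡b →
    let (πy , gy) = sends⇒ y ya≡b
        (πy′ , gy′) = sends⇒ y′ y′a≡b
    in same-row (gy∈G , gy) (gy′∈G , gy′) , same-permutation (πy∈T , πy) (πy′∈T , πy′)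
  where
  sends⇒ : ∀ y → act₂ y ((c₁ , i₁) , (c₂ , i₂)) ≡ ((d₁ , j₁) , (d₂ , j₂)) →
    (π y ⟨$⟩ʳ i₁ ≡ j₁ × π y ⟨$⟩ʳ i₂ ≡ j₂) × (g y j₁ ≡ d₁ ⊖ c₁ × g y j₂ ≡ d₂ ⊖ c₂)
  sends⇒ y ya≡b =
    let (πi₁ , gj₁) = act-≡⁻ y c₁ i₁ d₁ j₁ (cong proj₁ ya≡b)
        (πi₂ , gj₂) = act-≡⁻ y c₂ i₂ d₂ j₂ (cong proj₂ ya≡b)
    in (πi₁ , πi₂) , (gj₁ , gj₂)

module PlaneProperties (P : ProjectivePlane) where
  open ProjectivePlane P

  Point : Set
  Point = Fin nPoints

  Line : Set
  Line = Fin nLines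

  infix 4 _∈ₗ_ _∉ₗ_ _∈?_

  _∈ₗ_ : Point → Line → Set
  x ∈ₗ L = T (I x L)

  _∉ₗ_ : Point → Line → Set
  x ∉ₗ L = ¬ x ∈ₗ L

  _∈?_ : (x : Point) (L : Line) → Dec (x ∈ₗ L)
  x ∈? L = T? (I x L)

  line : (x y : Point) → x ≢ y → Line
  line x y x≢y = proj₁ (line-unique x y x≢y)

  ∈-lineˡ : ∀ {x y} (x≢y : x ≢ y) → x ∈ₗ line x y x≢y
  ∈-lineˡ {x} {y} x≢y = proj₁ (proj₁ (proj₂ (line-unique x y x≢y)))

  ∈-lineʳ : ∀ {x y} (x≢y : x ≢ y) → y ∈ₗ line x y x≢y
  ∈-lineʳ {x} {y} x≢y = proj₂ (proj₁ (proj₂ (line-unique x y x≢y)))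

  meet : (L M : Line) → L ≢ M → Point
  meet L M L≢M = proj₁ (point-unique L M L≢M)

  ∈-meetˡ : ∀ {L M} (L≢M : L ≢ M) → meet L M L≢M ∈ₗ L
  ∈-meetˡ {L} {M} L≢M = proj₁ (proj₁ (proj₂ (point-unique L M L≢M)))

  ∈-meetʳ : ∀ {L M} (L≢M : L ≢ M) → meet L M L≢M ∈ₗ M
  ∈-meetʳ {L} {M} L≢M = proj₂ (proj₁ (proj₂ (point-unique L M L≢M)))

  lines-coincide : ∀ {x y L M} → x ≢ y → x ∈ₗ L → y ∈ₗ L → x ∈ₗ M → y ∈ₗ M → L ≡ M
  lines-coincide {x} {y} {L} {M} x≢y x∈L y∈L x∈M y∈M =
    trans (unique L x∈L y∈L) (sym (unique M x∈M y∈M))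
    where
    unique : ∀ K → x ∈ₗ K → y ∈ₗ K → K ≡ line x y x≢y
    unique = proj₂ (proj₂ (line-unique x y x≢y))

  points-coincide : ∀ {x y L M} → L ≢ M → x ∈ₗ L → x ∈ₗ M → y ∈ₗ L → y ∈ₗ M → x ≡ y
  points-coincide {x} {y} {L} {M} L≢M x∈L x∈M y∈L y∈M =
    trans (unique x x∈L x∈M) (sym (unique y y∈L y∈M))
    where
    unique : ∀ z → z ∈ₗ L → z ∈ₗ M → z ≡ meet L M L≢M
    unique = proj₂ (proj₂ (point-unique L M L≢M))

  ∈∉⇒≢ : ∀ {x y L} → x ∈ₗ L → y ∉ₗ L → x ≢ y
  ∈∉⇒≢ x∈L y∉L refl = y∉L x∈L

  ∈∉⇒≢ₗ : ∀ {x L M} → x ∈ₗ L → x ∉ₗ M → L ≢ M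
  ∈∉⇒≢ₗ x∈L x∉M refl = x∉M x∈L

  module _ {N K₁ K₂ : Line} {y₁ y₂ : Point} (y₁≢y₂ : y₁ ≢ y₂) (y₁∈N : y₁ ∈ₗ N) (y₂∈N : y₂ ∈ₗ N)
           (y₁∈K₁ : y₁ ∈ₗ K₁) (y₂∈K₂ : y₂ ∈ₗ K₂) (K₁≢N : K₁ ≢ N) where

    lines-through-distinct-points-≢ : K₁ ≢ K₂
    lines-through-distinct-points-≢ refl = K₁≢N (lines-coincide y₁≢y₂ y₁∈K₁ y₂∈K₂ y₁∈N y₂∈N)

    common-point-∉ : K₂ ≢ N → ∀ {x} → x ∈ₗ K₁ → x ∈ₗ K₂ → x ∉ₗ N
    common-point-∉ K₂≢N x∈K₁ x∈K₂ x∈N =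
      y₁≢y₂ (trans (points-coincide K₁≢N y₁∈K₁ y₁∈N x∈K₁ x∈N) (points-coincide K₂≢N x∈K₂ x∈N y₂∈K₂ y₂∈N))

  private
    record Triangle : Set where
      field
        a b c : Point
        a≢b : a ≢ b
        a≢c : a ≢ c
        b≢c : b ≢ c
        noncollinear : ∀ L → ¬ (a ∈ₗ L × b ∈ₗ L × c ∈ₗ L)

    triangle : Triangle
    triangle =
      let (a , b , c , _ , (a≢b , a≢c , _ , b≢c , _) , noncollinear , _) = nondeg
      in record { a = a ; b = b ; c = c ; a≢b = a≢b ; a≢c = a≢c ; b≢c = b≢c ; noncollinear = noncollinear }

    open Triangle triangle

  ℓ₁ ℓ₂ : Line
  ℓ₁ = line a b a≢b
  ℓ₂ = line a c a≢c

  ℓ₁≢ℓ₂ : ℓ₁ ≢ ℓ₂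
  ℓ₁≢ℓ₂ ℓ₁≡ℓ₂ = noncollinear ℓ₁ (∈-lineˡ a≢b , ∈-lineʳ a≢b , subst (c ∈ₗ_) (sym ℓ₁≡ℓ₂) (∈-lineʳ a≢c))

  line-avoiding : (p : Point) → Σ Line (p ∉ₗ_)
  line-avoiding p with p ∈? ℓ₁ | p ∈? ℓ₂
  ... | no p∉ℓ₁ | _       = ℓ₁ , p∉ℓ₁
  ... | yes _   | no p∉ℓ₂ = ℓ₂ , p∉ℓ₂
  ... | yes p∈ℓ₁ | yes p∈ℓ₂ = line b c b≢c , λ p∈bc →
    noncollinear _ (subst (_∈ₗ _) (points-coincide ℓ₁≢ℓ₂ p∈ℓ₁ p∈ℓ₂ (∈-lineˡ a≢b) (∈-lineˡ a≢c)) p∈bc ,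
                    ∈-lineˡ b≢c , ∈-lineʳ b≢c)

  module LineEnumeration {m : ℕ} (order : HasOrder P m) (L : Line) where
    private
      _∈L? : (x : Point) → Dec (x ∈ₗ L)
      x ∈L? = x ∈? L

    point : Fin (suc m) → Point
    point i = lookup (pointsOn L) (cast (sym (order L)) i)

    point-∈ : ∀ i → point i ∈ₗ L
    point-∈ i = proj₂ (∈-filter⁻ _∈L? {xs = allFin nPoints} (∈-lookup _))

    point-injective : ∀ {i j} → point i ≡ point j → i ≡ j
    point-injective {i} {j} eq = begin
      i                                        ≡⟨ cast-involutive (order L) (sym (order L)) i ⟨
      cast (order L) (cast (sym (order L)) i)  ≡⟨ cong (cast (order L)) (lookup-injective unique eq) ⟩
      cast (order L) (cast (sym (order L)) j)  ≡⟨ cast-involutive (order L) (sym (order L)) j ⟩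
      j                                        ∎
      where
      open ≡-Reasoning
      unique : Unique (pointsOn L)
      unique = Unique.filter⁺ _∈L? (Unique.allFin⁺ nPoints)

    index : (x : Point) → x ∈ₗ L → Fin (suc m)
    index x x∈L = cast (order L) (Any.index (∈-filter⁺ _∈L? (∈-allFin x) x∈L))

    point-index : ∀ {x} (x∈L : x ∈ₗ L) → point (index x x∈L) ≡ x
    point-index {x} x∈L = trans (cong (lookup (pointsOn L)) (cast-involutive (sym (order L)) (order L) _))
                                (sym (lookup-index (∈-filter⁺ _∈L? (∈-allFin x) x∈L)))

  -- The points of M off N, enumerated by Fin m, and the pencils of lines through points of N
  -- (other than N) labelled by where they cross M.
  module Transversal {m : ℕ} (order : HasOrder P m) (N M : Line) (M≢N : M ≢ N) where
    private
      module E = LineEnumeration order M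

      hole : Fin (suc m)
      hole = E.index (meet M N M≢N) (∈-meetˡ M≢N)

      point-hole : E.point hole ≡ meet M N M≢N
      point-hole = E.point-index (∈-meetˡ M≢N)

    point : Fin m → Point
    point v = E.point (punchIn hole v)

    point-∈ : ∀ v → point v ∈ₗ M
    point-∈ v = E.point-∈ _

    point-∉ : ∀ v → point v ∉ₗ N
    point-∉ v v∈N = punchInᵢ≢i hole v (E.point-injective (trans
      (points-coincide M≢N (point-∈ v) v∈N (∈-meetˡ M≢N) (∈-meetʳ M≢N)) (sym point-hole)))

    point-injective : ∀ {u v} → point u ≡ point v → u ≡ v
    point-injective = punchIn-injective hole _ _ ∘ E.point-injective

    index : (x : Point) → x ∈ₗ M → x ∉ₗ N → Fin m
    index x x∈M x∉N = punchOut {i = hole} {j = E.index x x∈M} λ hole≡x →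
      x∉N (subst (_∈ₗ N) (trans (sym point-hole) (trans (cong E.point hole≡x) (E.point-index x∈M)))
                         (∈-meetʳ M≢N))

    point-index : ∀ {x} (x∈M : x ∈ₗ M) (x∉N : x ∉ₗ N) → point (index x x∈M x∉N) ≡ x
    point-index x∈M x∉N = trans (cong E.point (punchIn-punchOut _)) (E.point-index x∈M)

    module Pencil (y : Point) (y∈N : y ∈ₗ N) (y∉M : y ∉ₗ M) where

      ray : Fin m → Line
      ray v = line y (point v) (≢-sym (∈∉⇒≢ (point-∈ v) y∉M))

      centre∈ray : ∀ v → y ∈ₗ ray v
      centre∈ray v = ∈-lineˡ _

      point∈ray : ∀ v → point v ∈ₗ ray v
      point∈ray v = ∈-lineʳ _

      ray≢N : ∀ v → ray v ≢ N
      ray≢N v = ∈∉⇒≢ₗ (point∈ray v) (point-∉ v)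

      ray≢M : ∀ v → ray v ≢ M
      ray≢M v = ∈∉⇒≢ₗ (centre∈ray v) y∉M

      private
        join : (x : Point) → x ∉ₗ N → Line
        join x x∉N = line x y (≢-sym (∈∉⇒≢ y∈N x∉N))

        join≢M : ∀ {x} (x∉N : x ∉ₗ N) → join x x∉N ≢ M
        join≢M x∉N = ∈∉⇒≢ₗ (∈-lineʳ _) y∉M

        foot : (x : Point) → x ∉ₗ N → Point
        foot x x∉N = meet (join x x∉N) M (join≢M x∉N)

        foot∈join : ∀ {x} (x∉N : x ∉ₗ N) → foot x x∉N ∈ₗ join x x∉N
        foot∈join x∉N = ∈-meetˡ (join≢M x∉N)

        foot∈M : ∀ {x} (x∉N : x ∉ₗ N) → foot x x∉N ∈ₗ M
        foot∈M x∉N = ∈-meetʳ (join≢M x∉N)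

        foot∉N : ∀ {x} (x∉N : x ∉ₗ N) → foot x x∉N ∉ₗ N
        foot∉N x∉N foot∈N = y∉M (subst (_∈ₗ M)
          (points-coincide (∈∉⇒≢ₗ (∈-lineˡ _) x∉N) (foot∈join x∉N) foot∈N (∈-lineʳ _) y∈N)
          (foot∈M x∉N))

      label : (x : Point) → x ∉ₗ N → Fin m
      label x x∉N = index (foot x x∉N) (foot∈M x∉N) (foot∉N x∉N)

      label≡⇒∈ray : ∀ {x v} (x∉N : x ∉ₗ N) → label x x∉N ≡ v → x ∈ₗ ray v
      label≡⇒∈ray {x} x∉N refl = subst (x ∈ₗ_) join≡ray (∈-lineˡ _)
        where
        point≡foot : point (label x x∉N) ≡ foot x x∉N
        point≡foot = point-index (foot∈M x∉N) (foot∉N x∉N)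

        join≡ray : join x x∉N ≡ ray (label x x∉N)
        join≡ray = lines-coincide (∈∉⇒≢ y∈N (point-∉ _))
          (∈-lineʳ _) (subst (_∈ₗ join x x∉N) (sym point≡foot) (foot∈join x∉N))
          (centre∈ray _) (point∈ray _)

      ∈ray⇒label≡ : ∀ {x v} (x∉N : x ∉ₗ N) → x ∈ₗ ray v → label x x∉N ≡ v
      ∈ray⇒label≡ {x} {v} x∉N x∈ray = point-injective (trans (point-index (foot∈M x∉N) (foot∉N x∉N)) foot≡point)
        where
        ray≡join : ray v ≡ join x x∉N
        ray≡join = lines-coincide (≢-sym (∈∉⇒≢ y∈N x∉N)) x∈ray (centre∈ray v) (∈-lineˡ _) (∈-lineʳ _)
        foot≡point : foot x x∉N ≡ point v
        foot≡point = points-coincide (ray≢M v)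
          (subst (foot x x∉N ∈ₗ_) (sym ray≡join) (foot∈join x∉N)) (foot∈M x∉N) (point∈ray v) (point-∈ v)

      label-cong : ∀ {x x′} (x∉N : x ∉ₗ N) (x′∉N : x′ ∉ₗ N) → x ≡ x′ → label x x∉N ≡ label x′ x′∉N
      label-cong x∉N x′∉N refl = sym (∈ray⇒label≡ x′∉N (label≡⇒∈ray x∉N refl))

module AffineOrthogonalArray {q : ℕ} (P : ProjectivePlane) (order : HasOrder P q) where
  open PlaneProperties P

  L∞ : Line
  L∞ = ℓ₁

  module Columns = LineEnumeration order L∞

  column : Fin (suc q) → Point
  column = Columns.point

  transversal : Fin (suc q) → Line
  transversal j = proj₁ (line-avoiding (column j))

  column∉transversal : ∀ j → column j ∉ₗ transversal j
  column∉transversal j = proj₂ (line-avoiding (column j))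

  module Direction (j : Fin (suc q)) =
    Transversal.Pencil order L∞ (transversal j)
      (≢-sym (∈∉⇒≢ₗ (Columns.point-∈ j) (column∉transversal j)))
      (column j) (Columns.point-∈ j) (column∉transversal j)

  row : (x : Point) → x ∉ₗ L∞ → Fin (suc q) → Fin q
  row x x∉L∞ j = Direction.label j x x∉L∞

  Rows : (Fin (suc q) → Fin q) → Set
  Rows f = Σ Point λ x → Σ (x ∉ₗ L∞) λ x∉L∞ → f ≗ row x x∉L∞

  orthogonal : OrthogonalArray Rows
  orthogonal {j₁} {j₂} j₁≢j₂ v₁ v₂ =
    (row x x∉L∞ , (x , x∉L∞ , λ _ → refl) ,
       Direction.∈ray⇒label≡ j₁ x∉L∞ (∈-meetˡ K₁≢K₂) , Direction.∈ray⇒label≡ j₂ x∉L∞ (∈-meetʳ K₁≢K₂)) ,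
    λ { {f} {f′} ((z , z∉L∞ , f≗z) , fj₁ , fj₂) ((z′ , z′∉L∞ , f′≗z′) , f′j₁ , f′j₂) j →
        let (z∈K₁ , z∈K₂) = on-K₁-and-K₂ f z∉L∞ f≗z fj₁ fj₂
            (z′∈K₁ , z′∈K₂) = on-K₁-and-K₂ f′ z′∉L∞ f′≗z′ f′j₁ f′j₂
            z≡z′ : z ≡ z′
            z≡z′ = points-coincide K₁≢K₂ z∈K₁ z∈K₂ z′∈K₁ z′∈K₂
        in trans (f≗z j) (trans (Direction.label-cong j z∉L∞ z′∉L∞ z≡z′) (sym (f′≗z′ j))) }
    where
    K₁ K₂ : Line
    K₁ = Direction.ray j₁ v₁
    K₂ = Direction.ray j₂ v₂

    columns-≢ : column j₁ ≢ column j₂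
    columns-≢ = j₁≢j₂ ∘ Columns.point-injective

    K₁≢K₂ : K₁ ≢ K₂
    K₁≢K₂ = lines-through-distinct-points-≢ columns-≢ (Columns.point-∈ j₁) (Columns.point-∈ j₂)
              (Direction.centre∈ray j₁ v₁) (Direction.centre∈ray j₂ v₂) (Direction.ray≢N j₁ v₁)

    x : Point
    x = meet K₁ K₂ K₁≢K₂

    x∉L∞ : x ∉ₗ L∞
    x∉L∞ = common-point-∉ columns-≢ (Columns.point-∈ j₁) (Columns.point-∈ j₂)
              (Direction.centre∈ray j₁ v₁) (Direction.centre∈ray j₂ v₂) (Direction.ray≢N j₁ v₁)
              (Direction.ray≢N j₂ v₂) (∈-meetˡ K₁≢K₂) (∈-meetʳ K₁≢K₂)

    on-K₁-and-K₂ : ∀ f {z} (z∉L∞ : z ∉ₗ L∞) → f ≗ row z z∉L∞ → f j₁ ≡ v₁ → f j₂ ≡ v₂ → z ∈ₗ K₁ × z ∈ₗ K₂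
    on-K₁-and-K₂ _ z∉L∞ f≗z fj₁ fj₂ = Direction.label≡⇒∈ray j₁ z∉L∞ (trans (sym (f≗z j₁)) fj₁) ,
                                 Direction.label≡⇒∈ray j₂ z∉L∞ (trans (sym (f≗z j₂)) fj₂)

module Perspectivities {n : ℕ} (P : ProjectivePlane) (order : HasOrder P n) where
  open PlaneProperties P

  module Target = Transversal order ℓ₂ ℓ₁ ℓ₁≢ℓ₂
  module Source = Transversal order ℓ₁ ℓ₂ (≢-sym ℓ₁≢ℓ₂)

  module From (i : Fin n) = Target.Pencil (Source.point i) (Source.point-∈ i) (Source.point-∉ i)
  module To (j : Fin n) = Source.Pencil (Target.point j) (Target.point-∈ j) (Target.point-∉ j)

  cross : Fin n → Fin n → Line
  cross i j = From.ray i j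

  To-ray≡cross : ∀ i j → To.ray j i ≡ cross i j
  To-ray≡cross i j = lines-coincide (∈∉⇒≢ (Target.point-∈ j) (Source.point-∉ i))
    (To.centre∈ray j i) (To.point∈ray j i) (From.point∈ray i j) (From.centre∈ray i j)

  Centre : Set
  Centre = Σ Point λ D → D ∉ₗ ℓ₁ × D ∉ₗ ℓ₂

  project : Centre → Fin n → Fin n
  project (D , _ , D∉ℓ₂) i = From.label i D D∉ℓ₂

  unproject : Centre → Fin n → Fin n
  unproject (D , D∉ℓ₁ , _) j = To.label j D D∉ℓ₁

  module _ (C : Centre) {i j : Fin n} where
    private
      D : Point
      D = proj₁ C

    project-≡⁺ : D ∈ₗ cross i j → project C i ≡ j
    project-≡⁺ = From.∈ray⇒label≡ i (proj₂ (proj₂ C))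

    project-≡⁻ : project C i ≡ j → D ∈ₗ cross i j
    project-≡⁻ = From.label≡⇒∈ray i (proj₂ (proj₂ C))

    unproject-≡⁺ : D ∈ₗ cross i j → unproject C j ≡ i
    unproject-≡⁺ D∈cross = To.∈ray⇒label≡ j (proj₁ (proj₂ C)) (subst (D ∈ₗ_) (sym (To-ray≡cross i j)) D∈cross)

    unproject-≡⁻ : unproject C j ≡ i → D ∈ₗ cross i j
    unproject-≡⁻ eq = subst (D ∈ₗ_) (To-ray≡cross i j) (To.label≡⇒∈ray j (proj₁ (proj₂ C)) eq)

  project-cong : ∀ C C′ → proj₁ C ≡ proj₁ C′ → project C ≗ project C′
  project-cong (_ , _ , D∉ℓ₂) (_ , _ , D′∉ℓ₂) D≡D′ i = From.label-cong i D∉ℓ₂ D′∉ℓ₂ D≡D′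

  perspectivity : Centre → Permutation′ n
  perspectivity C = permutation (project C) (unproject C)
    (λ _ → project-≡⁺ C (unproject-≡⁻ C refl)) (λ _ → unproject-≡⁺ C (project-≡⁻ C refl))

  Perspectivity : Permutation′ n → Set
  Perspectivity σ = Σ Centre λ C → (σ ⟨$⟩ʳ_) ≗ project C

  sharplyTwoTransitive : SharplyTwoTransitive Perspectivity
  sharplyTwoTransitive {i₁} {i₂} {j₁} {j₂} i₁≢i₂ j₁≢j₂ =
    (perspectivity C , (C , λ _ → refl) , project-≡⁺ C (∈-meetˡ K₁≢K₂) , project-≡⁺ C (∈-meetʳ K₁≢K₂)) ,
    λ { {σ} {τ} ((C′ , σ≗C′) , σi₁ , σi₂) ((C″ , τ≗C″) , τi₁ , τi₂) i →
        let (C′∈K₁ , C′∈K₂) = on-K₁-and-K₂ σ C′ σ≗C′ σi₁ σi₂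
            (C″∈K₁ , C″∈K₂) = on-K₁-and-K₂ τ C″ τ≗C″ τi₁ τi₂
        in trans (σ≗C′ i) (trans (project-cong C′ C″ (points-coincide K₁≢K₂ C′∈K₁ C′∈K₂ C″∈K₁ C″∈K₂) i)
                                 (sym (τ≗C″ i))) }
    where
    K₁ K₂ : Line
    K₁ = cross i₁ j₁
    K₂ = cross i₂ j₂

    sources-≢ : Source.point i₁ ≢ Source.point i₂
    sources-≢ = i₁≢i₂ ∘ Source.point-injective

    targets-≢ : Target.point j₁ ≢ Target.point j₂
    targets-≢ = j₁≢j₂ ∘ Target.point-injective

    K₁≢K₂ : K₁ ≢ K₂
    K₁≢K₂ = lines-through-distinct-points-≢ sources-≢ (Source.point-∈ i₁) (Source.point-∈ i₂)
              (From.centre∈ray i₁ j₁) (From.centre∈ray i₂ j₂) (From.ray≢N i₁ j₁)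

    D : Point
    D = meet K₁ K₂ K₁≢K₂

    D∉ℓ₂ : D ∉ₗ ℓ₂
    D∉ℓ₂ = common-point-∉ sources-≢ (Source.point-∈ i₁) (Source.point-∈ i₂)
              (From.centre∈ray i₁ j₁) (From.centre∈ray i₂ j₂) (From.ray≢N i₁ j₁)
              (From.ray≢N i₂ j₂) (∈-meetˡ K₁≢K₂) (∈-meetʳ K₁≢K₂)

    D∉ℓ₁ : D ∉ₗ ℓ₁
    D∉ℓ₁ = common-point-∉ targets-≢ (Target.point-∈ j₁) (Target.point-∈ j₂)
              (From.point∈ray i₁ j₁) (From.point∈ray i₂ j₂) (From.ray≢M i₁ j₁)
              (From.ray≢M i₂ j₂) (∈-meetˡ K₁≢K₂) (∈-meetʳ K₁≢K₂)

    C : Centre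
    C = D , D∉ℓ₁ , D∉ℓ₂

    on-K₁-and-K₂ : ∀ σ C′ → (σ ⟨$⟩ʳ_) ≗ project C′ → σ ⟨$⟩ʳ i₁ ≡ j₁ → σ ⟨$⟩ʳ i₂ ≡ j₂ →
               proj₁ C′ ∈ₗ K₁ × proj₁ C′ ∈ₗ K₂
    on-K₁-and-K₂ _ C′ σ≗C′ σi₁ σi₂ = project-≡⁻ C′ (trans (sym (σ≗C′ i₁)) σi₁) ,
                               project-≡⁻ C′ (trans (sym (σ≗C′ i₂)) σi₂)

theorem8p3 : (n : ℕ) → 2 ≤ n →
    ¬ (Σ (Wr (n ∸ 1) n → Set) λ Y → SharplyTransitive Y) →
    ¬ (ExistsProjectivePlane (n ∸ 1) × ExistsProjectivePlane n)
theorem8p3 (suc (suc k)) (s≤s (s≤s z≤n)) no-design ((P₁ , order₁) , (P₂ , order₂)) =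
  no-design (_ , ⋊-sharplyTransitive (AffineOrthogonalArray.orthogonal P₁ order₁)
                                     (Perspectivities.sharplyTwoTransitive P₂ order₂))
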